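{- For every graph $G$ and every positive integer $k$, $\mathrm{rb}_2(G)\le \max(2, k, \beta^\rho_k(G))$.
   Context: For $S\subseteq V(G)$, the cut-rank $\rho_G(S)$ is the rank over the binary field of the $S\times (V(G)\setminus S)$ adjacency submatrix. The $\rho_G$-width of a partition $(X_1,\dots,X_m)$ of $V(G)$ is $\max\{\rho_G(\bigcup_{i\in I}X_i): I\subseteq\{1,\dots,m\}\}$. The rank $k$-brittleness $\beta^\rho_k(G)$ is the minimum $\rho_G$-width over all partitions of $V(G)$ into parts of size at most $k$. A decomposition of $G$ is a pair $(T,\sigma)$ of a tree $T$ with at least one internal node and a bijection $\sigma$ from $V(G)$ to the leaves of $T$; its radius is the radius of $T$. For an internal node $t$, the components of $T-t$ give (via $\sigma$) a partition of $V(G)$; the width of $t$ is the $\rho_G$-width of this partition; the width of $(T,\sigma)$ is the maximum width of an internal node. The depth-$2$ rank-brittleness $\mathrm{rb}_2(G)$ is the minimum $k$ such that $G$ admits a decomposition of width at most $k$ and radius at most $2$, and is $0$ if $|V(G)|<2$. -}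

module Defs where

open import Data.Nat using (ℕ; zero; suc; _≤_; _<_)
open import Data.Fin using (Fin; zero; suc; _≟_)
open import Data.Bool using (Bool; true; false; _xor_; _∧_)
open import Data.Product using (Σ; ∃; ∃-syntax; _×_; _,_)
open import Data.Sum using (_⊎_)
open import Relation.Nullary using (¬_)
open import Relation.Nullary.Decidable using (⌊_⌋)
open import Relation.Binary.PropositionalEquality using (_≡_; _≢_)
open import Relation.Binary.Construct.Closure.ReflexiveTransitive using (Star)

record Graph (n : ℕ) : Set where
  field
    adj        : Fin n → Fin n → Bool
    adj-sym    : ∀ u v → adj u v ≡ adj v u
    adj-irrefl : ∀ v → adj v v ≡ false
open Graph public

count : ∀ {n} → (Fin n → Bool) → ℕ
count {zero}  P = zero
count {suc n} P with P zero
... | true  = suc (count (λ i → P (suc i)))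
... | false = count (λ i → P (suc i))

xorSum : ∀ {m} → (Fin m → Bool) → Bool
xorSum {zero}  f = false
xorSum {suc m} f = f zero xor xorSum (λ i → f (suc i))

-- Cut-rank: rank over GF(2) of the S × (V∖S) adjacency submatrix,
-- i.e. the maximum number of GF(2)-linearly independent rows.
-- Subsets of V(G) are characteristic functions Fin n → Bool.

IsRowFamily : ∀ {n m} → (S : Fin n → Bool) → (Fin m → Fin n) → Set
IsRowFamily S rows = ∀ i → S (rows i) ≡ true

RowsIndependent : ∀ {n m} → Graph n → (S : Fin n → Bool) → (Fin m → Fin n) → Set
RowsIndependent {n} {m} G S rows =
  (c : Fin m → Bool) →
  (∀ v → S v ≡ false → xorSum (λ i → c i ∧ adj G (rows i) v) ≡ false) →
  ∀ i → c i ≡ false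

CutRankAtMost : ∀ {n} → Graph n → (Fin n → Bool) → ℕ → Set
CutRankAtMost {n} G S w =
  ∀ m (rows : Fin m → Fin n) → IsRowFamily S rows → RowsIndependent G S rows → m ≤ w

-- Rank k-brittleness.
-- A partition (X_1,…,X_m) of V(G) is given by a labelling f : V(G) → Fin m,
-- X_i = f⁻¹(i) (empty parts are harmless: they change neither part sizes
-- bound nor the width).

PartsAtMost : ∀ {n m} → (Fin n → Fin m) → ℕ → Set
PartsAtMost {n} {m} f k = ∀ (i : Fin m) → count (λ v → ⌊ f v ≟ i ⌋) ≤ k

PartitionWidthAtMost : ∀ {n m} → Graph n → (Fin n → Fin m) → ℕ → Set
PartitionWidthAtMost {n} {m} G f w =
  ∀ (I : Fin m → Bool) → CutRankAtMost G (λ v → I (f v)) w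

IsRankBrittleness : ∀ {n} → Graph n → ℕ → ℕ → Set
IsRankBrittleness {n} G k b =
  (∃[ m ] Σ (Fin n → Fin m) λ f → PartsAtMost f k × PartitionWidthAtMost G f b)
  × (∀ m (f : Fin n → Fin m) w → PartsAtMost f k → PartitionWidthAtMost G f w → b ≤ w)

-- Trees (as finite simple graphs on Fin N: connected, and acyclic in the
-- form "every edge is a bridge")

module _ {N : ℕ} (adjT : Fin N → Fin N → Bool) where
  Edge : Fin N → Fin N → Set
  Edge x y = adjT x y ≡ true

  EdgeWithout : Fin N → Fin N → Fin N → Fin N → Set
  EdgeWithout x y a b = Edge a b × ¬ ((a ≡ x × b ≡ y) ⊎ (a ≡ y × b ≡ x))

  EdgeAvoiding : Fin N → Fin N → Fin N → Set
  EdgeAvoiding t a b = Edge a b × a ≢ t × b ≢ t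

record Tree (N : ℕ) : Set where
  field
    tadj        : Fin N → Fin N → Bool
    tadj-sym    : ∀ x y → tadj x y ≡ tadj y x
    tadj-irrefl : ∀ x → tadj x x ≡ false
    connected   : ∀ x y → Star (Edge tadj) x y
    acyclic     : ∀ x y → tadj x y ≡ true → ¬ Star (EdgeWithout tadj x y) x y
open Tree public

Leaf : ∀ {N} → Tree N → Fin N → Set
Leaf T t = ∀ u v → tadj T t u ≡ true → tadj T t v ≡ true → u ≡ v

record Decomposition {n : ℕ} (G : Graph n) : Set where
  field
    N        : ℕ
    T        : Tree N
    σ        : Fin n → Fin N
    σ-inj    : ∀ u v → σ u ≡ σ v → u ≡ v
    σ-leaf   : ∀ v → Leaf T (σ v)
    σ-onto   : ∀ t → Leaf T t → ∃[ v ] σ v ≡ t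
    internal : ∃[ t ] ¬ Leaf T t
open Decomposition public

RadiusAtMost2 : ∀ {n} {G : Graph n} → Decomposition G → Set
RadiusAtMost2 D =
  ∃[ c ] ∀ x → x ≡ c ⊎ tadj (T D) c x ≡ true
              ⊎ (∃[ y ] tadj (T D) c y ≡ true × tadj (T D) y x ≡ true)

-- A set S is a
-- union of such parts iff it is closed under "σ u, σ v lie in the same
-- component of T - t".
NodeWidthAtMost : ∀ {n} {G : Graph n} (D : Decomposition G) → Fin (N D) → ℕ → Set
NodeWidthAtMost {n} {G} D t w =
  ∀ (S : Fin n → Bool) →
  (∀ u v → Star (EdgeAvoiding (tadj (T D)) t) (σ D u) (σ D v) → S u ≡ S v) →
  CutRankAtMost G S w

DecompWidthAtMost : ∀ {n} {G : Graph n} → Decomposition G → ℕ → Set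
DecompWidthAtMost D w = ∀ t → ¬ Leaf (T D) t → NodeWidthAtMost D t w

IsRb2 : ∀ {n} → Graph n → ℕ → Set
IsRb2 {n} G r =
  (n < 2 × r ≡ 0)
  ⊎ (2 ≤ n
     × (Σ (Decomposition G) λ D → RadiusAtMost2 D × DecompWidthAtMost D r)
     × (∀ (D : Decomposition G) w → RadiusAtMost2 D → DecompWidthAtMost D w → r ≤ w))

-- Let b = β^ρ_k(G) and w = max(2, k, b), and take a partition (X₁,…,Xₘ) of V(G) into
-- parts of size ≤ k whose ρ_G-width is ≤ b ≤ w.  We may assume that every part is
-- nonempty and m ≥ 2 (with a single part, |V(G)| ≤ k bounds every cut-rank, and
-- any two-part partition will do).  Let T have a root, a hub hᵢ adjacent to the root
-- for each part, and a leaf for each vertex v ∈ Xᵢ adjacent to hᵢ; T has radius 2.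
-- The components of T - root are the parts, so the root has width ≤ b ≤ w.  The
-- components of T - hᵢ are the singletons {v} (v ∈ Xᵢ) and V(G) ∖ Xᵢ, so every union
-- S of them has S ⊆ Xᵢ or V(G) ∖ S ⊆ Xᵢ; as ρ_G(S) ≤ min(|S|, |V(G) ∖ S|) (a matrix
-- has rank at most its number of rows and of columns), hᵢ has width ≤ k ≤ w.  By
-- minimality, rb₂(G) ≤ w.

module Submission where

open import Defs
open import Algebra.Bundles using (CommutativeRing)
open import Data.Bool using (Bool; true; false; not; _xor_; _∧_)
import Data.Bool.Properties as Bool
open import Data.Empty using (⊥-elim)
open import Data.Fin using (Fin; zero; suc; _≟_; punchIn; punchOut; splitAt; _↑ˡ_; _↑ʳ_; join)
open import Data.Fin.Properties
  using (punchInᵢ≢i; punchIn-punchOut; punchOut-cong; punchOut-punchIn; suc-injective;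
         injective⇒≤; any?; all?; ¬∀⟶∃¬; splitAt-↑ˡ; splitAt-↑ʳ; join-splitAt)
open import Data.Nat using (ℕ; zero; suc; _≤_; _+_; _⊔_; z≤n; s≤s)
open import Data.Nat.Properties using (≤-trans; ≤-reflexive; m≤n⇒m≤1+n; m≤m⊔n; m≤n⊔m)
open import Data.Product using (∃-syntax; _×_; _,_; proj₁; proj₂)
import Data.Product as Product
open import Data.Sum using (_⊎_; inj₁; inj₂; [_,_]′)
import Data.Sum as Sum
open import Data.Vec.Functional using (insertAt)
open import Data.Vec.Functional.Properties using (insertAt-lookup; insertAt-punchIn)
open import Function using (_∘_)
open import Relation.Nullary using (Dec; yes; no; ¬_)
open import Relation.Nullary.Decidable using (⌊_⌋)
open import Relation.Binary.PropositionalEquality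
open import Relation.Binary.Construct.Closure.ReflexiveTransitive
  using (Star; ε; _◅_; _◅◅_; gmap; fold; reverse)
open import Algebra.Properties.CommutativeSemigroup
  (CommutativeRing.+-commutativeSemigroup Bool.xor-∧-commutativeRing)
  using (interchange; x∙yz≈y∙xz)

true≢false : true ≢ false
true≢false ()

⌊⌋-true : ∀ {p} {P : Set p} (P? : Dec P) → P → ⌊ P? ⌋ ≡ true
⌊⌋-true (yes _) _ = refl
⌊⌋-true (no ¬p) p = ⊥-elim (¬p p)

⌊⌋-false : ∀ {p} {P : Set p} (P? : Dec P) → ¬ P → ⌊ P? ⌋ ≡ false
⌊⌋-false (yes p) ¬p = ⊥-elim (¬p p)
⌊⌋-false (no _) _ = refl

⌊⌋-sound : ∀ {p} {P : Set p} (P? : Dec P) → ⌊ P? ⌋ ≡ true → P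
⌊⌋-sound (yes p) _ = p

⌊⌋-cong : ∀ {p q} {P : Set p} {Q : Set q} → (P → Q) → (Q → P) →
          (P? : Dec P) (Q? : Dec Q) → ⌊ P? ⌋ ≡ ⌊ Q? ⌋
⌊⌋-cong P→Q Q→P (yes p) Q? = sym (⌊⌋-true Q? (P→Q p))
⌊⌋-cong P→Q Q→P (no ¬p) Q? = sym (⌊⌋-false Q? (¬p ∘ Q→P))

xorSum-cong : ∀ {m} {f g : Fin m → Bool} → (∀ i → f i ≡ g i) → xorSum f ≡ xorSum g
xorSum-cong {zero} _ = refl
xorSum-cong {suc m} f≗g = cong₂ _xor_ (f≗g zero) (xorSum-cong (f≗g ∘ suc))

xorSum-false : ∀ {m} → xorSum {m} (λ _ → false) ≡ false
xorSum-false {zero} = refl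
xorSum-false {suc m} = xorSum-false {m}

xorSum-xor : ∀ {m} (f g : Fin m → Bool) → xorSum (λ i → f i xor g i) ≡ xorSum f xor xorSum g
xorSum-xor {zero} f g = refl
xorSum-xor {suc m} f g =
  trans (cong ((f zero xor g zero) xor_) (xorSum-xor (f ∘ suc) (g ∘ suc)))
        (interchange (f zero) (g zero) (xorSum (f ∘ suc)) (xorSum (g ∘ suc)))

xorSum-∧ʳ : ∀ {m} (f : Fin m → Bool) b → xorSum (λ i → f i ∧ b) ≡ xorSum f ∧ b
xorSum-∧ʳ {zero} f b = refl
xorSum-∧ʳ {suc m} f b =
  trans (cong ((f zero ∧ b) xor_) (xorSum-∧ʳ (f ∘ suc) b))
        (sym (Bool.∧-distribʳ-xor b (f zero) (xorSum (f ∘ suc))))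

xorSum-punchIn : ∀ {m} (p : Fin (suc m)) (f : Fin (suc m) → Bool) →
                 xorSum f ≡ f p xor xorSum (f ∘ punchIn p)
xorSum-punchIn zero f = refl
xorSum-punchIn {suc m} (suc p) f =
  trans (cong (f zero xor_) (xorSum-punchIn p (f ∘ suc)))
        (x∙yz≈y∙xz (f zero) (f (suc p)) _)

xorSum-δ : ∀ {m} (i : Fin m) (g : Fin m → Bool) → xorSum (λ x → ⌊ x ≟ i ⌋ ∧ g x) ≡ g i
xorSum-δ {suc m} i g = begin
  xorSum (λ x → ⌊ x ≟ i ⌋ ∧ g x)
    ≡⟨ xorSum-punchIn i (λ x → ⌊ x ≟ i ⌋ ∧ g x) ⟩
  (⌊ i ≟ i ⌋ ∧ g i) xor xorSum (λ j → ⌊ punchIn i j ≟ i ⌋ ∧ g (punchIn i j))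
    ≡⟨ cong₂ _xor_ (cong (_∧ g i) (⌊⌋-true (i ≟ i) refl))
                   (xorSum-cong (λ j → cong (_∧ g (punchIn i j))
                                  (⌊⌋-false (punchIn i j ≟ i) (punchInᵢ≢i i j)))) ⟩
  g i xor xorSum {m} (λ _ → false)
    ≡⟨ cong (g i xor_) (xorSum-false {m}) ⟩
  g i xor false
    ≡⟨ Bool.xor-identityʳ (g i) ⟩
  g i ∎
  where open ≡-Reasoning

count-mono : ∀ {n} (P Q : Fin n → Bool) → (∀ v → P v ≡ true → Q v ≡ true) → count P ≤ count Q
count-mono {zero} P Q P⊆Q = z≤n
count-mono {suc n} P Q P⊆Q with P zero | Q zero | P⊆Q zero
... | true  | true  | _ = s≤s (count-mono (P ∘ suc) (Q ∘ suc) (P⊆Q ∘ suc))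
... | true  | false | 0∉Q with 0∉Q refl
...   | ()
count-mono {suc n} P Q P⊆Q | false | true  | _ = m≤n⇒m≤1+n (count-mono (P ∘ suc) (Q ∘ suc) (P⊆Q ∘ suc))
count-mono {suc n} P Q P⊆Q | false | false | _ = count-mono (P ∘ suc) (Q ∘ suc) (P⊆Q ∘ suc)

count-all : ∀ n → count {n} (λ _ → true) ≡ n
count-all zero = refl
count-all (suc n) = cong suc (count-all n)

count≤size : ∀ {n} (P : Fin n → Bool) → count P ≤ n
count≤size {n} P = subst (count P ≤_) (count-all n) (count-mono P (λ _ → true) (λ _ _ → refl))

-- The position of an element v ∈ S in the increasing enumeration of S; it is
-- injective, which bounds by |S| the size of any family of distinct elements of S.
position : ∀ {n} (S : Fin n → Bool) v → S v ≡ true → Fin (count S)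
position {suc n} S zero Sv with S zero
position {suc n} S zero refl | true = zero
position {suc n} S (suc v) Sv with S zero
... | true  = suc (position (S ∘ suc) v Sv)
... | false = position (S ∘ suc) v Sv

position-injective : ∀ {n} (S : Fin n → Bool) u v (Su : S u ≡ true) (Sv : S v ≡ true) →
                     position S u Su ≡ position S v Sv → u ≡ v
position-injective {suc n} S zero zero Su Sv _ = refl
position-injective {suc n} S zero (suc v) Su Sv eq with S zero
position-injective {suc n} S zero (suc v) refl Sv () | true
position-injective {suc n} S (suc u) zero Su Sv eq with S zero
position-injective {suc n} S (suc u) zero Su refl () | true
position-injective {suc n} S (suc u) (suc v) Su Sv eq with S zero
... | true  = cong suc (position-injective (S ∘ suc) u v Su Sv (suc-injective eq))
... | false = cong suc (position-injective (S ∘ suc) u v Su Sv eq)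

combination : ∀ {m n} → (Fin m → Bool) → (Fin m → Fin n → Bool) → Fin n → Bool
combination c M v = xorSum (λ i → c i ∧ M i v)

-- The rows of M, restricted to the columns outside S, are linearly independent.
-- For M i = adj G (rows i) this is exactly RowsIndependent G S rows.
Independent : ∀ {m n} → (Fin m → Fin n → Bool) → (Fin n → Bool) → Set
Independent M S =
  ∀ c → (∀ v → S v ≡ false → combination c M v ≡ false) → ∀ i → c i ≡ false

-- Independent rows are distinct: two equal rows i ≠ j give the dependency δᵢ + δⱼ.
independent-distinct : ∀ {m n} (M : Fin m → Fin n → Bool) S → Independent M S →
                       ∀ i j → (∀ v → M i v ≡ M j v) → i ≡ j
independent-distinct M S ind i j Mi≗Mj with i ≟ j
... | yes i≡j = i≡j
... | no i≢j = ⊥-elim (true≢false (trans (sym ci≡true) (ind c c-dependent i)))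
  where
  c : _ → Bool
  c x = ⌊ x ≟ i ⌋ xor ⌊ x ≟ j ⌋
  ci≡true : c i ≡ true
  ci≡true = cong₂ _xor_ (⌊⌋-true (i ≟ i) refl) (⌊⌋-false (i ≟ j) i≢j)
  c-dependent : ∀ v → S v ≡ false → combination c M v ≡ false
  c-dependent v _ = begin
    combination c M v
      ≡⟨ xorSum-cong (λ x → Bool.∧-distribʳ-xor (M x v) ⌊ x ≟ i ⌋ ⌊ x ≟ j ⌋) ⟩
    xorSum (λ x → (⌊ x ≟ i ⌋ ∧ M x v) xor (⌊ x ≟ j ⌋ ∧ M x v))
      ≡⟨ xorSum-xor (λ x → ⌊ x ≟ i ⌋ ∧ M x v) (λ x → ⌊ x ≟ j ⌋ ∧ M x v) ⟩
    xorSum (λ x → ⌊ x ≟ i ⌋ ∧ M x v) xor xorSum (λ x → ⌊ x ≟ j ⌋ ∧ M x v)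
      ≡⟨ cong₂ _xor_ (xorSum-δ i (λ x → M x v)) (xorSum-δ j (λ x → M x v)) ⟩
    M i v xor M j v
      ≡⟨ cong (_xor M j v) (Mi≗Mj v) ⟩
    M j v xor M j v
      ≡⟨ Bool.xor-same (M j v) ⟩
    false ∎
    where open ≡-Reasoning

-- Column bound (rank ≤ number of columns outside S) by Gaussian elimination on the
-- first column; each of the three cases below removes that column.
dropColumn : ∀ {m n} → (Fin m → Fin (suc n) → Bool) → Fin m → Fin n → Bool
dropColumn M i v = M i (suc v)

dropColumn-inside : ∀ {m n} (M : Fin m → Fin (suc n) → Bool) S → S zero ≡ true →
                    Independent M S → Independent (dropColumn M) (S ∘ suc)
dropColumn-inside M S S0 ind c dep = ind c λ
  { zero S0≡false → ⊥-elim (true≢false (trans (sym S0) S0≡false))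
  ; (suc v) Sv → dep v Sv }

dropColumn-zero : ∀ {m n} (M : Fin m → Fin (suc n) → Bool) S → (∀ i → M i zero ≡ false) →
                  Independent M S → Independent (dropColumn M) (S ∘ suc)
dropColumn-zero {m} M S col0 ind c dep = ind c λ
  { zero _ → trans (xorSum-cong (λ i → trans (cong (c i ∧_) (col0 i)) (Bool.∧-zeroʳ (c i))))
                   (xorSum-false {m})
  ; (suc v) Sv → dep v Sv }

-- Pivoting on a row p with a 1 in the first column: add row p to every other row
-- with a 1 there, then delete row p and the first column.
eliminate : ∀ {m n} → (Fin (suc m) → Fin (suc n) → Bool) → Fin (suc m) → Fin m → Fin n → Bool
eliminate M p j v = M (punchIn p j) (suc v) xor (M (punchIn p j) zero ∧ M p (suc v))

-- Pivoting keeps the remaining rows independent: a dependency c of the reduced rows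
-- lifts to the dependency of M that puts coefficient a = Σⱼ cⱼ Mⱼ₀ on row p.
eliminate-independent : ∀ {m n} (M : Fin (suc m) → Fin (suc n) → Bool) S p → M p zero ≡ true →
                        Independent M S → Independent (eliminate M p) (S ∘ suc)
eliminate-independent M S p pivot ind c dep j =
  trans (sym (insertAt-punchIn c p a j)) (ind lifted lifted-dependent (punchIn p j))
  where
  open ≡-Reasoning
  rest : Fin _ → Fin _ → Bool
  rest = M ∘ punchIn p
  a : Bool
  a = combination c rest zero
  lifted : Fin _ → Bool
  lifted = insertAt c p a
  split : ∀ v → combination lifted M v ≡ (a ∧ M p v) xor combination c rest v
  split v = begin
    combination lifted M v
      ≡⟨ xorSum-punchIn p (λ i → lifted i ∧ M i v) ⟩
    (lifted p ∧ M p v) xor xorSum (λ j → lifted (punchIn p j) ∧ rest j v)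
      ≡⟨ cong₂ _xor_ (cong (_∧ M p v) (insertAt-lookup c p a))
                     (xorSum-cong (λ j → cong (_∧ rest j v) (insertAt-punchIn c p a j))) ⟩
    (a ∧ M p v) xor combination c rest v ∎
  reduced : ∀ v → combination c (eliminate M p) v ≡ combination c rest (suc v) xor (a ∧ M p (suc v))
  reduced v = begin
    combination c (eliminate M p) v
      ≡⟨ xorSum-cong (λ j → Bool.∧-distribˡ-xor (c j) (rest j (suc v)) _) ⟩
    xorSum (λ j → (c j ∧ rest j (suc v)) xor (c j ∧ (rest j zero ∧ M p (suc v))))
      ≡⟨ xorSum-xor (λ j → c j ∧ rest j (suc v)) (λ j → c j ∧ (rest j zero ∧ M p (suc v))) ⟩
    combination c rest (suc v) xor xorSum (λ j → c j ∧ (rest j zero ∧ M p (suc v)))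
      ≡⟨ cong (combination c rest (suc v) xor_)
              (trans (xorSum-cong (λ j → sym (Bool.∧-assoc (c j) (rest j zero) (M p (suc v)))))
                     (xorSum-∧ʳ (λ j → c j ∧ rest j zero) (M p (suc v)))) ⟩
    combination c rest (suc v) xor (a ∧ M p (suc v)) ∎
  lifted-dependent : ∀ v → S v ≡ false → combination lifted M v ≡ false
  lifted-dependent zero _ = begin
    combination lifted M zero  ≡⟨ split zero ⟩
    (a ∧ M p zero) xor a       ≡⟨ cong (λ x → (a ∧ x) xor a) pivot ⟩
    (a ∧ true) xor a           ≡⟨ cong (_xor a) (Bool.∧-identityʳ a) ⟩
    a xor a                    ≡⟨ Bool.xor-same a ⟩
    false ∎
  lifted-dependent (suc v) Sv = begin
    combination lifted M (suc v)
      ≡⟨ split (suc v) ⟩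
    (a ∧ M p (suc v)) xor combination c rest (suc v)
      ≡⟨ Bool.xor-comm (a ∧ M p (suc v)) _ ⟩
    combination c rest (suc v) xor (a ∧ M p (suc v))
      ≡⟨ sym (reduced v) ⟩
    combination c (eliminate M p) v
      ≡⟨ dep v Sv ⟩
    false ∎

rank≤outside : ∀ n {m} (M : Fin m → Fin n → Bool) S → Independent M S →
               m ≤ count (λ v → not (S v))
rank≤outside zero {zero} M S ind = z≤n
rank≤outside zero {suc m} M S ind with ind (λ _ → true) (λ ()) zero
... | ()
rank≤outside (suc n) M S ind with S zero in S0
... | true = rank≤outside n (dropColumn M) (S ∘ suc) (dropColumn-inside M S S0 ind)
rank≤outside (suc n) {m} M S ind | false with any? (λ p → M p zero Bool.≟ true)
rank≤outside (suc n) {suc m} M S ind | false | yes (p , pivot) =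
  s≤s (rank≤outside n (eliminate M p) (S ∘ suc) (eliminate-independent M S p pivot ind))
... | no noPivot =
  m≤n⇒m≤1+n (rank≤outside n (dropColumn M) (S ∘ suc)
    (dropColumn-zero M S (λ i → Bool.¬-not (λ Mi0 → noPivot (i , Mi0))) ind))

cutRank≤size : ∀ {n} (G : Graph n) S → CutRankAtMost G S (count S)
cutRank≤size G S m rows inS ind =
  injective⇒≤ {f = λ i → position S (rows i) (inS i)} λ {i} {j} eq →
  independent-distinct (λ i → adj G (rows i)) S ind i j
    (λ v → cong (λ x → adj G x v) (position-injective S (rows i) (rows j) (inS i) (inS j) eq))

cutRank≤outside : ∀ {n} (G : Graph n) S → CutRankAtMost G S (count (λ v → not (S v)))
cutRank≤outside {n} G S m rows _ ind = rank≤outside n (λ i → adj G (rows i)) S ind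

cutRank-weaken : ∀ {n} (G : Graph n) S {w w′} → w ≤ w′ → CutRankAtMost G S w → CutRankAtMost G S w′
cutRank-weaken G S w≤w′ ρ≤w m rows inS ind = ≤-trans (ρ≤w m rows inS ind) w≤w′

cutRank-cong : ∀ {n} (G : Graph n) {S S′} {w} → (∀ v → S v ≡ S′ v) →
               CutRankAtMost G S w → CutRankAtMost G S′ w
cutRank-cong G S≗S′ ρ≤w m rows inS′ ind =
  ρ≤w m rows (λ i → trans (S≗S′ (rows i)) (inS′ i))
          (λ c dep → ind c (λ v S′v → dep v (trans (S≗S′ v) S′v)))

cutRank≤vertices : ∀ {n} (G : Graph n) S {w} → n ≤ w → CutRankAtMost G S w
cutRank≤vertices G S n≤w = cutRank-weaken G S (≤-trans (count≤size S) n≤w) (cutRank≤size G S)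

cutRank-oneSideIn : ∀ {n} (G : Graph n) (S X : Fin n → Bool) {w} →
                    (∀ v → S v ≡ true → X v ≡ true) ⊎ (∀ v → S v ≡ false → X v ≡ true) →
                    count X ≤ w → CutRankAtMost G S w
cutRank-oneSideIn G S X (inj₁ S⊆X) X≤w =
  cutRank-weaken G S (≤-trans (count-mono S X S⊆X) X≤w) (cutRank≤size G S)
cutRank-oneSideIn G S X (inj₂ ∁S⊆X) X≤w =
  cutRank-weaken G S (≤-trans (count-mono (λ v → not (S v)) X ∁S⊆X′) X≤w) (cutRank≤outside G S)
  where
  ∁S⊆X′ : ∀ v → not (S v) ≡ true → X v ≡ true
  ∁S⊆X′ v notSv = ∁S⊆X v (Bool.not-injective notSv)

-- Deleting a label i carried by no vertex (labels above i shift down by one) keeps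
-- the part sizes and the ρ_G-width: unions of the new parts are unions of the old ones.
module _ {n m} (f : Fin n → Fin (suc m)) (i : Fin (suc m)) (unused : ∀ v → i ≢ f v) where

  withoutLabel : Fin n → Fin m
  withoutLabel v = punchOut (unused v)

  withoutLabel-part : ∀ j v → ⌊ withoutLabel v ≟ j ⌋ ≡ ⌊ f v ≟ punchIn i j ⌋
  withoutLabel-part j v = ⌊⌋-cong
    (λ eq → trans (sym (punchIn-punchOut (unused v))) (cong (punchIn i) eq))
    (λ eq → trans (punchOut-cong i eq) (punchOut-punchIn i))
    (withoutLabel v ≟ j) (f v ≟ punchIn i j)

  withoutLabel-small : ∀ {k} → PartsAtMost f k → PartsAtMost withoutLabel k
  withoutLabel-small small j =
    ≤-trans (count-mono _ _ (λ v inj → trans (sym (withoutLabel-part j v)) inj)) (small (punchIn i j))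

  withoutLabel-narrow : ∀ (G : Graph n) {w} →
                        PartitionWidthAtMost G f w → PartitionWidthAtMost G withoutLabel w
  withoutLabel-narrow G narrow I = cutRank-cong G same-set (narrow (insertAt I i false))
    where
    same-set : ∀ v → insertAt I i false (f v) ≡ I (withoutLabel v)
    same-set v = trans (cong (insertAt I i false) (sym (punchIn-punchOut (unused v))))
                       (insertAt-punchIn I i false (withoutLabel v))

record CoveringPartition {n} (G : Graph n) (k w : ℕ) : Set where
  constructor covering
  field
    labels : ℕ
    label  : Fin n → Fin labels
    small  : PartsAtMost label k
    narrow : PartitionWidthAtMost G label w
    used   : ∀ i → ∃[ v ] label v ≡ i

dropUnusedLabels : ∀ {n} (G : Graph n) {k w} m (f : Fin n → Fin m) →
                   PartsAtMost f k → PartitionWidthAtMost G f w → CoveringPartition G k w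
dropUnusedLabels G zero f small narrow = covering zero f small narrow (λ ())
dropUnusedLabels G (suc m) f small narrow with all? (λ i → any? (λ v → f v ≟ i))
... | yes used = covering (suc m) f small narrow used
... | no notAllUsed with ¬∀⟶∃¬ (suc m) _ (λ i → any? (λ v → f v ≟ i)) notAllUsed
...   | i , unusedᵢ = dropUnusedLabels G m (withoutLabel f i unused)
                        (withoutLabel-small f i unused small) (withoutLabel-narrow f i unused G narrow)
  where
  unused : ∀ v → i ≢ f v
  unused v i≡fv = unusedᵢ (v , sym i≡fv)

record HubPartition {n} (G : Graph n) (k w : ℕ) : Set where
  field
    extra     : ℕ
    label     : Fin n → Fin (2 + extra)
    small     : PartsAtMost label k
    narrow    : PartitionWidthAtMost G label w
    rep       : Fin (2 + extra) → Fin n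
    rep-label : ∀ i → label (rep i) ≡ i

-- With a single part, all n vertices lie in it, so n ≤ k ≤ w bounds every cut-rank
-- and the partition {v₀}, V ∖ {v₀} serves instead.
hubPartition : ∀ {n} (G : Graph n) {k w} → 2 ≤ n → k ≤ w → CoveringPartition G k w → HubPartition G k w
hubPartition {zero} G () _ _
hubPartition {suc zero} G (s≤s ()) _ _
hubPartition {suc (suc n)} G _ _ (covering zero f _ _ _) with f zero
... | ()
hubPartition {suc (suc n)} G {k} {w} _ k≤w (covering (suc zero) f small _ _) = record
  { extra     = zero
  ; label     = firstVertex
  ; small     = λ j → ≤-trans (count≤size (λ v → ⌊ firstVertex v ≟ j ⌋)) n≤k
  ; narrow    = λ I → cutRank≤vertices G (λ v → I (firstVertex v)) (≤-trans n≤k k≤w)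
  ; rep       = firstTwo
  ; rep-label = λ { zero → refl ; (suc zero) → refl }
  }
  where
  firstTwo : Fin 2 → Fin (suc (suc n))
  firstTwo zero = zero
  firstTwo (suc zero) = suc zero
  firstVertex : Fin (suc (suc n)) → Fin 2
  firstVertex zero = zero
  firstVertex (suc _) = suc zero
  onlyLabel : ∀ v → f v ≡ zero
  onlyLabel v with f v
  ... | zero = refl
  n≤k : suc (suc n) ≤ k
  n≤k = ≤-trans (≤-reflexive (sym (count-all (suc (suc n)))))
                (≤-trans (count-mono (λ _ → true) (λ v → ⌊ f v ≟ zero ⌋)
                                     (λ v _ → ⌊⌋-true (f v ≟ zero) (onlyLabel v)))
                         (small zero))
hubPartition {suc (suc n)} G _ _ (covering (suc (suc m)) f small narrow used) = record
  { extra = m ; label = f ; small = small ; narrow = narrow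
  ; rep = proj₁ ∘ used ; rep-label = proj₂ ∘ used }

module _ {A : Set} (isEdge : A → A → Bool) where

  Link : A → A → Set
  Link a b = isEdge a b ≡ true

  LinkOtherThan : A → A → A → A → Set
  LinkOtherThan x y a b = Link a b × ¬ ((a ≡ x × b ≡ y) ⊎ (a ≡ y × b ≡ x))

  LinkAvoiding : A → A → A → Set
  LinkAvoiding t a b = Link a b × a ≢ t × b ≢ t

  IsLeaf : A → Set
  IsLeaf a = ∀ b b′ → Link a b → Link a b′ → b ≡ b′

invariant-separates : ∀ {A : Set} {R : A → A → Set} (s : A → Bool) →
                      (∀ {a b} → R a b → s a ≡ s b) → ∀ {x y} → s x ≢ s y → ¬ Star R x y
invariant-separates s invariant s≢ path =
  s≢ (fold (λ a b → s a ≡ s b) (λ r eq → trans (invariant r) eq) refl path)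

module Transport {A : Set} {nodes : ℕ} (isEdge : A → A → Bool)
  (encode : A → Fin nodes) (decode : Fin nodes → A)
  (decode-encode : ∀ a → decode (encode a) ≡ a) (encode-decode : ∀ x → encode (decode x) ≡ x)
  (isEdge-sym : ∀ a b → isEdge a b ≡ isEdge b a) (isEdge-irrefl : ∀ a → isEdge a a ≡ false)
  (connectedA : ∀ a b → Star (Link isEdge) a b)
  (acyclicA : ∀ a b → Link isEdge a b → ¬ Star (LinkOtherThan isEdge a b) a b) where

  edgeF : Fin nodes → Fin nodes → Bool
  edgeF x y = isEdge (decode x) (decode y)

  decode-injective : ∀ {x y} → decode x ≡ decode y → x ≡ y
  decode-injective {x} {y} eq = trans (sym (encode-decode x)) (trans (cong encode eq) (encode-decode y))

  encode-injective : ∀ {a b} → encode a ≡ encode b → a ≡ b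
  encode-injective {a} {b} eq = trans (sym (decode-encode a)) (trans (cong decode eq) (decode-encode b))

  link⇒edge : ∀ {x y a b} → decode x ≡ a → decode y ≡ b → Link isEdge a b → Edge edgeF x y
  link⇒edge refl refl l = l

  liftLink : ∀ {a b} → Link isEdge a b → Edge edgeF (encode a) (encode b)
  liftLink = link⇒edge (decode-encode _) (decode-encode _)

  tree : Tree nodes
  tree = record
    { tadj = edgeF
    ; tadj-sym = λ x y → isEdge-sym (decode x) (decode y)
    ; tadj-irrefl = λ x → isEdge-irrefl (decode x)
    ; connected = λ x y → subst₂ (Star (Edge edgeF)) (encode-decode x) (encode-decode y)
                            (gmap encode liftLink (connectedA (decode x) (decode y)))
    ; acyclic = λ x y l path → acyclicA (decode x) (decode y) l (gmap decode projectLink path)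
    }
    where
    projectLink : ∀ {x y a b} → EdgeWithout edgeF x y a b →
                  LinkOtherThan isEdge (decode x) (decode y) (decode a) (decode b)
    projectLink (l , other) =
      l , other ∘ Sum.map (Product.map decode-injective decode-injective)
                          (Product.map decode-injective decode-injective)

  leaf⇒ : ∀ x → IsLeaf isEdge (decode x) → Leaf tree x
  leaf⇒ x L y y′ l l′ = decode-injective (L (decode y) (decode y′) l l′)

  leaf⇐ : ∀ x → Leaf tree x → IsLeaf isEdge (decode x)
  leaf⇐ x L b b′ l l′ = encode-injective
    (L (encode b) (encode b′) (link⇒edge refl (decode-encode b) l) (link⇒edge refl (decode-encode b′) l′))

  liftAvoiding : ∀ t {a b} → Star (LinkAvoiding isEdge (decode t)) a b →
                 Star (EdgeAvoiding edgeF t) (encode a) (encode b)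
  liftAvoiding t = gmap encode λ (l , a≢t , b≢t) → liftLink l , avoid a≢t , avoid b≢t
    where
    avoid : ∀ {a} → a ≢ decode t → encode a ≢ t
    avoid {a} a≢t refl = a≢t (sym (decode-encode a))

  within2 : ∀ c → (∀ a → a ≡ c ⊎ Link isEdge c a ⊎ ∃[ b ] Link isEdge c b × Link isEdge b a) →
            ∀ x → x ≡ encode c ⊎ edgeF (encode c) x ≡ true
                ⊎ ∃[ y ] edgeF (encode c) y ≡ true × edgeF y x ≡ true
  within2 c near x with near (decode x)
  ... | inj₁ x≡c = inj₁ (trans (sym (encode-decode x)) (cong encode x≡c))
  ... | inj₂ (inj₁ l) = inj₂ (inj₁ (link⇒edge (decode-encode c) refl l))
  ... | inj₂ (inj₂ (b , l , l′)) =
    inj₂ (inj₂ (encode b , liftLink l , link⇒edge (decode-encode b) refl l′))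

module TwoLevel {n m} (label : Fin n → Fin m) where

  data Node : Set where
    root : Node
    leaf : Fin n → Node
    hub  : Fin m → Node

  isEdge : Node → Node → Bool
  isEdge root     (hub _)  = true
  isEdge (hub _)  root     = true
  isEdge (leaf v) (hub i)  = ⌊ label v ≟ i ⌋
  isEdge (hub i)  (leaf v) = ⌊ label v ≟ i ⌋
  isEdge _        _        = false

  isEdge-sym : ∀ a b → isEdge a b ≡ isEdge b a
  isEdge-sym root     root     = refl
  isEdge-sym root     (leaf _) = refl
  isEdge-sym root     (hub _)  = refl
  isEdge-sym (leaf _) root     = refl
  isEdge-sym (leaf _) (leaf _) = refl
  isEdge-sym (leaf _) (hub _)  = refl
  isEdge-sym (hub _)  root     = refl
  isEdge-sym (hub _)  (leaf _) = refl
  isEdge-sym (hub _)  (hub _)  = refl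

  isEdge-irrefl : ∀ a → isEdge a a ≡ false
  isEdge-irrefl root     = refl
  isEdge-irrefl (leaf _) = refl
  isEdge-irrefl (hub _)  = refl

  leaf-hub : ∀ v → Link isEdge (leaf v) (hub (label v))
  leaf-hub v = ⌊⌋-true (label v ≟ label v) refl

  hub-leaf : ∀ v → Link isEdge (hub (label v)) (leaf v)
  hub-leaf v = ⌊⌋-true (label v ≟ label v) refl

  link-label : ∀ {v i} → Link isEdge (leaf v) (hub i) → label v ≡ i
  link-label {v} {i} = ⌊⌋-sound (label v ≟ i)

  hub-root : ∀ i → Link isEdge (hub i) root
  hub-root i = refl

  root-hub : ∀ i → Link isEdge root (hub i)
  root-hub i = refl

  toRoot : ∀ a → Star (Link isEdge) a root
  toRoot root     = ε
  toRoot (leaf v) = leaf-hub v ◅ toRoot (hub (label v))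
  toRoot (hub i)  = hub-root i ◅ ε

  link-sym : ∀ a b → Link isEdge a b → Link isEdge b a
  link-sym a b l = trans (isEdge-sym b a) l

  connectedNodes : ∀ a b → Star (Link isEdge) a b
  connectedNodes a b = toRoot a ◅◅ reverse (λ {a} {b} → link-sym a b) (toRoot b)

  otherThan-flip : ∀ {x y a b} → LinkOtherThan isEdge x y a b → LinkOtherThan isEdge y x b a
  otherThan-flip {a = a} {b} (l , other) =
    link-sym a b l , other ∘ Sum.map Product.swap Product.swap

  -- Acyclicity: removing the edge root–hub i separates the branch of hub i, and
  -- removing the edge hub (label v)–leaf v separates leaf v; the other orientations
  -- follow by reversing paths.
  branch : Fin m → Node → Bool
  branch i root     = false
  branch i (leaf v) = ⌊ label v ≟ i ⌋
  branch i (hub j)  = ⌊ j ≟ i ⌋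

  branch-invariant : ∀ i {a b} → LinkOtherThan isEdge root (hub i) a b → branch i a ≡ branch i b
  branch-invariant i {root}   {hub j}  (_ , other) =
    sym (⌊⌋-false (j ≟ i) λ j≡i → other (inj₁ (refl , cong hub j≡i)))
  branch-invariant i {hub j}  {root}   (_ , other) =
    ⌊⌋-false (j ≟ i) λ j≡i → other (inj₂ (cong hub j≡i , refl))
  branch-invariant i {leaf v} {hub j}  (l , _) = cong (λ x → ⌊ x ≟ i ⌋) (link-label l)
  branch-invariant i {hub j}  {leaf v} (l , _) =
    cong (λ x → ⌊ x ≟ i ⌋) (sym (link-label (link-sym (hub j) (leaf v) l)))
  branch-invariant i {root}   {root}   (() , _)
  branch-invariant i {root}   {leaf _} (() , _)
  branch-invariant i {leaf _} {root}   (() , _)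
  branch-invariant i {leaf _} {leaf _} (() , _)
  branch-invariant i {hub _}  {hub _}  (() , _)

  single : Fin n → Node → Bool
  single v (leaf u) = ⌊ u ≟ v ⌋
  single v _        = false

  single-invariant : ∀ v {a b} → LinkOtherThan isEdge (hub (label v)) (leaf v) a b →
                     single v a ≡ single v b
  single-invariant v {leaf u} {hub j}  (l , other) =
    ⌊⌋-false (u ≟ v) λ { refl → other (inj₂ (refl , cong hub (sym (link-label l)))) }
  single-invariant v {hub j}  {leaf u} (l , other) =
    sym (⌊⌋-false (u ≟ v) λ { refl →
      other (inj₁ (cong hub (sym (link-label (link-sym (hub j) (leaf v) l))) , refl)) })
  single-invariant v {root}   {hub _}  _ = refl
  single-invariant v {hub _}  {root}   _ = refl
  single-invariant v {root}   {root}   (() , _)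
  single-invariant v {root}   {leaf _} (() , _)
  single-invariant v {leaf _} {root}   (() , _)
  single-invariant v {leaf _} {leaf _} (() , _)
  single-invariant v {hub _}  {hub _}  (() , _)

  acyclicNodes : ∀ a b → Link isEdge a b → ¬ Star (LinkOtherThan isEdge a b) a b
  acyclicNodes root (hub i) _ =
    invariant-separates (branch i) (branch-invariant i)
      λ eq → true≢false (sym (trans eq (⌊⌋-true (i ≟ i) refl)))
  acyclicNodes (hub i) (leaf v) l with link-label {v} {i} (link-sym (hub i) (leaf v) l)
  ... | refl = invariant-separates (single v) (single-invariant v)
                 λ eq → true≢false (sym (trans eq (⌊⌋-true (v ≟ v) refl)))
  acyclicNodes (hub i) root l path =
    acyclicNodes root (hub i) (link-sym (hub i) root l) (reverse otherThan-flip path)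
  acyclicNodes (leaf v) (hub i) l path =
    acyclicNodes (hub i) (leaf v) (link-sym (leaf v) (hub i) l) (reverse otherThan-flip path)
  acyclicNodes root root () _
  acyclicNodes root (leaf _) () _
  acyclicNodes (leaf _) root () _
  acyclicNodes (leaf _) (leaf _) () _
  acyclicNodes (hub _) (hub _) () _

  size : ℕ
  size = suc (n + m)

  encode : Node → Fin size
  encode root     = zero
  encode (leaf v) = suc (v ↑ˡ m)
  encode (hub i)  = suc (n ↑ʳ i)

  decode : Fin size → Node
  decode zero    = root
  decode (suc x) = [ leaf , hub ]′ (splitAt n x)

  decode-encode : ∀ a → decode (encode a) ≡ a
  decode-encode root     = refl
  decode-encode (leaf v) = cong [ leaf , hub ]′ (splitAt-↑ˡ n v m)
  decode-encode (hub i)  = cong [ leaf , hub ]′ (splitAt-↑ʳ n m i)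

  encode-decode : ∀ x → encode (decode x) ≡ x
  encode-decode zero    = refl
  encode-decode (suc x) = trans (encode-split (splitAt n x)) (cong suc (join-splitAt n m x))
    where
    encode-split : ∀ s → encode ([ leaf , hub ]′ s) ≡ suc (join n m s)
    encode-split (inj₁ v) = refl
    encode-split (inj₂ i) = refl

  open Transport isEdge encode decode decode-encode encode-decode
                 isEdge-sym isEdge-irrefl connectedNodes acyclicNodes public

  nearRoot : ∀ a → a ≡ root ⊎ Link isEdge root a ⊎ ∃[ b ] Link isEdge root b × Link isEdge b a
  nearRoot root     = inj₁ refl
  nearRoot (leaf v) = inj₂ (inj₂ (hub (label v) , root-hub (label v) , hub-leaf v))
  nearRoot (hub i)  = inj₂ (inj₁ (root-hub i))

  leaf-isLeaf : ∀ v → IsLeaf isEdge (leaf v)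
  leaf-isLeaf v (hub i)  (hub j)  l l′ = cong hub (trans (sym (link-label l)) (link-label l′))
  leaf-isLeaf v root     _        () _
  leaf-isLeaf v (leaf _) _        () _
  leaf-isLeaf v (hub _)  root     _  ()
  leaf-isLeaf v (hub _)  (leaf _) _  ()

  step : ∀ {t} a b → Link isEdge a b → a ≢ t → b ≢ t → Star (LinkAvoiding isEdge t) a b
  step a b l a≢t b≢t = (l , a≢t , b≢t) ◅ ε

module DepthTwo {n} (G : Graph n) {k w} (P : HubPartition G k w) (k≤w : k ≤ w) where
  open HubPartition P
  open TwoLevel label

  hub-rep : ∀ i → Link isEdge (hub i) (leaf (rep i))
  hub-rep i = ⌊⌋-true (label (rep i) ≟ i) (rep-label i)

  hub-injective : ∀ {i j} → hub i ≡ hub j → i ≡ j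
  hub-injective refl = refl

  leaf-injective : ∀ {u v} → leaf u ≡ leaf v → u ≡ v
  leaf-injective refl = refl

  -- The root has the two hubs 0 and 1, a hub i has the root and leaf (rep i).
  root-internal : ¬ IsLeaf isEdge root
  root-internal L with L (hub zero) (hub (suc zero)) (root-hub zero) (root-hub (suc zero))
  ... | ()

  hub-internal : ∀ i → ¬ IsLeaf isEdge (hub i)
  hub-internal i L with L root (leaf (rep i)) (hub-root i) (hub-rep i)
  ... | ()

  leafNode : ∀ a → IsLeaf isEdge a → ∃[ v ] a ≡ leaf v
  leafNode root     L = ⊥-elim (root-internal L)
  leafNode (leaf v) _ = v , refl
  leafNode (hub i)  L = ⊥-elim (hub-internal i L)

  decomposition : Decomposition G
  decomposition = record
    { N        = size
    ; T        = tree
    ; σ        = encode ∘ leaf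
    ; σ-inj    = λ u v eq → leaf-injective (encode-injective eq)
    ; σ-leaf   = λ v → leaf⇒ (encode (leaf v))
                           (subst (IsLeaf isEdge) (sym (decode-encode (leaf v))) (leaf-isLeaf v))
    ; σ-onto   = λ t L → onto t (leafNode (decode t) (leaf⇐ t L))
    ; internal = encode root , root-internal ∘ leaf⇐ (encode root)
    }
    where
    onto : ∀ t → ∃[ v ] decode t ≡ leaf v → ∃[ v ] encode (leaf v) ≡ t
    onto t (v , t↦v) = v , trans (cong encode (sym t↦v)) (encode-decode t)

  radius : RadiusAtMost2 decomposition
  radius = encode root , within2 root nearRoot

  -- S is a union of components of T - t.  Such an S is constant along node-level
  -- paths avoiding decode t, since these lift to paths in T - t.
  ClosedAt : Fin size → (Fin n → Bool) → Set
  ClosedAt t S = ∀ u v → Star (EdgeAvoiding edgeF t) (encode (leaf u)) (encode (leaf v)) → S u ≡ S v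

  closed : ∀ {t a} → decode t ≡ a → ∀ S → ClosedAt t S →
           ∀ {u v} → Star (LinkAvoiding isEdge a) (leaf u) (leaf v) → S u ≡ S v
  closed {t} refl S cl path = cl _ _ (liftAvoiding t path)

  -- Width of the root: the components of T - root are the parts, via their leaves
  -- joined at the hub, so S is a union of parts.
  rootWidth : ∀ t → decode t ≡ root → NodeWidthAtMost decomposition t w
  rootWidth t t↦root S cl = cutRank-cong G sameAsRep (narrow (λ j → S (rep j)))
    where
    sameAsRep : ∀ u → S (rep (label u)) ≡ S u
    sameAsRep u = sym (closed t↦root S cl
      (step (leaf u) (hub (label u)) (leaf-hub u) (λ ()) (λ ()) ◅◅
       step (hub (label u)) (leaf (rep (label u))) (hub-rep (label u)) (λ ()) (λ ())))

  -- Width of hub i: all vertices outside part i are joined through the root, hence all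
  -- lie on the side of the anchor rep (other i); so S or V ∖ S lies inside part i.
  other : Fin (2 + extra) → Fin (2 + extra)
  other zero    = suc zero
  other (suc _) = zero

  other-≢ : ∀ i → other i ≢ i
  other-≢ zero    ()
  other-≢ (suc _) ()

  inPart-if-differs : ∀ i (S : Fin n → Bool) {b} → (∀ u → label u ≢ i → S u ≡ b) →
                      ∀ v → S v ≢ b → ⌊ label v ≟ i ⌋ ≡ true
  inPart-if-differs i S outside v Sv≢b with label v ≟ i
  ... | yes _  = refl
  ... | no  ne = ⊥-elim (Sv≢b (outside v ne))

  hubWidth : ∀ i t → decode t ≡ hub i → NodeWidthAtMost decomposition t w
  hubWidth i t t↦hub S cl =
    cutRank-oneSideIn G S (λ v → ⌊ label v ≟ i ⌋) oneSide (≤-trans (small i) k≤w)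
    where
    anchor : Fin n
    anchor = rep (other i)
    outside : ∀ u → label u ≢ i → S u ≡ S anchor
    outside u ne = closed t↦hub S cl
      (step (leaf u) (hub (label u)) (leaf-hub u) (λ ()) (ne ∘ hub-injective) ◅◅
       step (hub (label u)) root (hub-root (label u)) (ne ∘ hub-injective) (λ ()) ◅◅
       step root (hub (other i)) (root-hub (other i)) (λ ()) (other-≢ i ∘ hub-injective) ◅◅
       step (hub (other i)) (leaf anchor) (hub-rep (other i)) (other-≢ i ∘ hub-injective) (λ ()))
    oneSide : (∀ v → S v ≡ true  → ⌊ label v ≟ i ⌋ ≡ true)
            ⊎ (∀ v → S v ≡ false → ⌊ label v ≟ i ⌋ ≡ true)
    oneSide with S anchor in anchorSide
    ... | false = inj₁ λ v Sv → inPart-if-differs i S (λ u ne → trans (outside u ne) anchorSide) v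
                                  (λ Sv≡false → true≢false (trans (sym Sv) Sv≡false))
    ... | true  = inj₂ λ v Sv → inPart-if-differs i S (λ u ne → trans (outside u ne) anchorSide) v
                                  (λ Sv≡true → true≢false (trans (sym Sv≡true) Sv))

  width : DecompWidthAtMost decomposition w
  width t notLeaf = nodeWidth (decode t) refl
    where
    nodeWidth : ∀ a → decode t ≡ a → NodeWidthAtMost decomposition t w
    nodeWidth root     t↦ = rootWidth t t↦
    nodeWidth (hub i)  t↦ = hubWidth i t t↦
    nodeWidth (leaf v) t↦ =
      ⊥-elim (notLeaf (leaf⇒ t (subst (IsLeaf isEdge) (sym t↦) (leaf-isLeaf v))))

-- For n < 2, rb₂(G) = 0; otherwise the
-- minimality of rb₂(G) applied to the depth-2 decomposition of the normalised optimal
-- partition, of width ≤ w = max(2, k, b).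
lemma4p1 : ∀ {n} (G : Graph n) (k : ℕ) → 1 ≤ k →
             ∀ r b → IsRb2 G r → IsRankBrittleness G k b → r ≤ 2 ⊔ (k ⊔ b)
lemma4p1 G k _ r b (inj₁ (_ , r≡0)) _ = subst (_≤ 2 ⊔ (k ⊔ b)) (sym r≡0) z≤n
lemma4p1 G k _ r b (inj₂ (2≤n , _ , minimal)) ((m , f , small , narrow) , _) =
  minimal decomposition w radius width
  where
  w : ℕ
  w = 2 ⊔ (k ⊔ b)
  k≤w : k ≤ w
  k≤w = ≤-trans (m≤m⊔n k b) (m≤n⊔m 2 (k ⊔ b))
  b≤w : b ≤ w
  b≤w = ≤-trans (m≤n⊔m k b) (m≤n⊔m 2 (k ⊔ b))
  narrow′ : PartitionWidthAtMost G f w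
  narrow′ I = cutRank-weaken G (λ v → I (f v)) b≤w (narrow I)
  partition : HubPartition G k w
  partition = hubPartition G 2≤n k≤w (dropUnusedLabels G m f small narrow′)
  open DepthTwo G partition k≤w
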